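{- Let $G$ be a connected graph of order $n\ge 2$ and let $H$ be a connected graph such that $\partial(H)=\sigma(H)$, and let $v\in V(H)$. (i) If $v\in\partial(H)$, then $\dim_s(G\circ_v H)=n(|\partial(H)|-1)-1$. (ii) If $v\notin\partial(H)$, then $\dim_s(G\circ_v H)=n|\partial(H)|-1$.
   Context: All graphs are finite and simple; $d$ denotes shortest-path distance in a connected graph. A vertex $w$ strongly resolves vertices $u,x$ if $d(w,u)=d(w,x)+d(x,u)$ or $d(w,x)=d(w,u)+d(u,x)$. A set $S$ of vertices is a strong metric generator if every pair of vertices is strongly resolved by some vertex of $S$; $\dim_s(X)$, the strong metric dimension, is the minimum cardinality of a strong metric generator of the connected graph $X$. A vertex $u$ is maximally distant from $w$ if for every neighbour $z$ of $u$, $d(w,z)\le d(u,w)$; $u,w$ are mutually maximally distant if each is maximally distant from the other. The boundary $\partial(X)$ is the set of vertices $u$ for which some vertex $w$ exists with $u,w$ mutually maximally distant. A vertex is simplicial if its neighbourhood induces a complete graph; $\sigma(X)$ is the set of simplicial vertices of $X$. Rooted product: for a graph $G$ with $V(G)=\{u_1,\dots,u_n\}$ and a graph $H$ with root $v$, $G\circ_v H$ has vertex set $V(G)\times V(H)$ and edge set $\bigcup_{i=1}^n\{(u_i,b)(u_i,y): by\in E(H)\}\cup\{(u_i,v)(u_j,v): u_iu_j\in E(G)\}$. -}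

module Defs where

open import Data.Nat using (ℕ; zero; suc; _+_; _*_; _≤_)
open import Data.Bool using (Bool; true; false; T; _∧_; _∨_)
open import Data.Fin using (Fin; remQuot; _≟_)
open import Data.Fin.Subset using (Subset; _∈_; ∣_∣)
open import Data.Product using (Σ; ∃; ∃-syntax; _×_; _,_)
open import Data.Sum using (_⊎_)
open import Relation.Nullary using (¬_)
open import Relation.Nullary.Decidable using (⌊_⌋)
open import Relation.Binary.PropositionalEquality using (_≡_; _≢_)

record Graph (n : ℕ) : Set where
  field
    adj : Fin n → Fin n → Bool

open Graph public

Edge : ∀ {n} → Graph n → Fin n → Fin n → Set
Edge G u w = T (adj G u w)

IsSimple : ∀ {n} → Graph n → Set
IsSimple G = (∀ u w → adj G u w ≡ adj G w u) × (∀ u → adj G u u ≡ false)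

data Walk {n} (G : Graph n) : Fin n → Fin n → ℕ → Set where
  here : ∀ {u} → Walk G u u 0
  step : ∀ {u z w k} → Edge G u z → Walk G z w k → Walk G u w (suc k)

Connected : ∀ {n} → Graph n → Set
Connected G = ∀ u w → ∃[ k ] Walk G u w k

Dist : ∀ {n} → Graph n → Fin n → Fin n → ℕ → Set
Dist G u w k = Walk G u w k × (∀ m → Walk G u w m → k ≤ m)

DistSum : ∀ {n} → Graph n → Fin n → Fin n → Fin n → Set
DistSum G w u x = ∃[ a ] ∃[ b ] ∃[ c ]
  (Dist G w u a × Dist G w x b × Dist G x u c × a ≡ b + c)

StronglyResolves : ∀ {n} → Graph n → Fin n → Fin n → Fin n → Set
StronglyResolves G w u x = DistSum G w u x ⊎ DistSum G w x u

IsStrongMetricGenerator : ∀ {n} → Graph n → Subset n → Set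
IsStrongMetricGenerator G S =
  ∀ u x → u ≢ x → ∃[ w ] (w ∈ S × StronglyResolves G w u x)

StrongMetricDimension : ∀ {n} → Graph n → ℕ → Set
StrongMetricDimension G k =
  (∃[ S ] (IsStrongMetricGenerator G S × ∣ S ∣ ≡ k)) ×
  (∀ S → IsStrongMetricGenerator G S → k ≤ ∣ S ∣)

MaximallyDistant : ∀ {n} → Graph n → Fin n → Fin n → Set
MaximallyDistant G u w =
  ∀ z → Edge G u z → ∀ a b → Dist G w z a → Dist G u w b → a ≤ b

MutuallyMaximallyDistant : ∀ {n} → Graph n → Fin n → Fin n → Set
MutuallyMaximallyDistant G u w = MaximallyDistant G u w × MaximallyDistant G w u

InBoundary : ∀ {n} → Graph n → Fin n → Set
InBoundary G u = ∃[ w ] MutuallyMaximallyDistant G u w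

Simplicial : ∀ {n} → Graph n → Fin n → Set
Simplicial G u = ∀ y z → Edge G u y → Edge G u z → y ≢ z → Edge G y z

-- Rooted product G ∘_v H. Vertex (u_i , b) is encoded as combine i b : Fin (n * m)
-- (remQuot is its inverse).
RootedProduct : ∀ {n m} → Graph n → Graph m → Fin m → Graph (n * m)
adj (RootedProduct {n} {m} G H v) p q with remQuot {n} m p | remQuot {n} m q
... | (i , b) | (j , y) =
  (⌊ i ≟ j ⌋ ∧ adj H b y) ∨ (⌊ b ≟ v ⌋ ∧ (⌊ y ≟ v ⌋ ∧ adj G i j))

-- Write X = G ∘_v H and ⟪ i , b ⟫ for its vertex (u_i , b). In any graph, a simplicial vertex is an
-- interior vertex of no geodesic, so a strong metric generator contains all but at most one of any set
-- of simplicial vertices; and any two vertices lie on a geodesic whose ends are mutually maximally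
-- distant, so a set B of simplicial vertices containing every maximally distant vertex yields
-- dim_s = |B| − 1. In X, a vertex ⟪ i , b ⟫ maximally distant from some vertex has b ≠ v and b maximally
-- distant in H, hence b ∈ ∂(H) = σ(H), and every such vertex is simplicial in X. Thus
-- B = V(G) × (∂(H) ∖ {v}), of size n (|∂(H)| − [v ∈ ∂(H)]).

module Submission where

open import Defs
open import Data.Nat using (ℕ; _*_; _∸_; _≤_)
open import Data.Fin using (Fin)
open import Data.Fin.Subset using (Subset; _∈_; _∉_; ∣_∣)
open import Data.Product using (_×_)
open import Function.Bundles using (_⇔_)

open import Data.Bool using (T; true; false; _∧_; _∨_)
open import Data.Bool.Properties using (T-∧; T-∨)
open import Data.Fin using (zero; suc; _≟_; punchIn; combine; remQuot)
open import Data.Fin.Properties using (any?; punchInᵢ≢i; remQuot-combine; combine-remQuot)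
open import Data.Fin.Subset using (_-_; ⁅_⁆; _⊆_; inside; outside)
open import Data.Fin.Subset.Properties
  using (_∈?_; nonempty?; Empty-unique; ∣⊥∣≡0; p─⊥≡p; p─q⊆p; x∈p∧x≢y⇒x∈p-y; p⊆q⇒∣p∣≤∣q∣)
open import Data.List using (List; filter; allFin)
open import Data.List.Extrema.Nat using (argmax; argmax-all; f[xs]≤f[argmax])
open import Data.List.Membership.Propositional.Properties using (∈-filter⁺; ∈-allFin)
import Data.List.Relation.Unary.All as All
open import Data.List.Relation.Unary.All.Properties using (all-filter)
open import Data.Nat using (zero; suc; _+_; z≤n; s≤s)
open import Data.Nat.Properties renaming (_≟_ to _≟ℕ_)
open import Data.Product using (_,_; ∃; ∃-syntax; proj₁; proj₂)
import Data.Product as Prod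
open import Data.Sum using (_⊎_; inj₁; inj₂)
import Data.Sum as Sum
open import Data.Vec using (_∷_; []; here; there; _++_; concat; replicate; lookup)
open import Data.Vec.Properties using (lookup-concat; lookup-replicate; []=⇒lookup; lookup⇒[]=)
open import Function using (_∘_; mk⇔; Equivalence)
open import Relation.Nullary using (¬_; Dec; yes; no; contradiction; ¬?)
open import Relation.Nullary.Decidable using (⌊_⌋; T?; _×-dec_; toWitness; fromWitness)
open import Relation.Unary using (Decidable)
open import Relation.Binary.PropositionalEquality
  using (_≡_; _≢_; refl; sym; trans; cong; cong₂; subst; subst₂; module ≡-Reasoning)

least-witness : ∀ {P : ℕ → Set} → Decidable P → ∀ {k} → P k →
                ∃[ j ] (P j × ∀ {i} → P i → j ≤ i)
least-witness P? {zero} p0 = 0 , p0 , λ _ → z≤n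
least-witness P? {suc k} pk with P? 0
... | yes p0 = 0 , p0 , λ _ → z≤n
... | no ¬p0 with least-witness (P? ∘ suc) pk
...   | j , pj , least = suc j , pj , λ { {zero} p0 → contradiction p0 ¬p0 ; {suc i} pi → s≤s (least pi) }

maximise : ∀ {N} {P : Fin N → Set} → Decidable P → (f : Fin N → ℕ) → ∀ {a} → P a →
           ∃[ t ] (P t × ∀ {s} → P s → f s ≤ f t)
maximise {N} P? f {a} pa =
  argmax f a candidates ,
  argmax-all f pa (all-filter P? (allFin N)) ,
  λ ps → All.lookup (f[xs]≤f[argmax] a candidates) (∈-filter⁺ P? (∈-allFin _) ps)
  where
  candidates : List (Fin N)
  candidates = filter P? (allFin N)

another : ∀ {N} → 2 ≤ N → (u : Fin N) → ∃[ w ] u ≢ w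
another (s≤s (s≤s _)) u = punchIn u zero , punchInᵢ≢i u zero ∘ sym

x∈p-y⇒x≢y : ∀ {N} {p : Subset N} {x y} → x ∈ p - y → x ≢ y
x∈p-y⇒x≢y {p = _ ∷ _} {suc x} {suc y} (there x∈p-y) refl = x∈p-y⇒x≢y x∈p-y refl

x∈p⇒suc∣p-x∣≡∣p∣ : ∀ {N} {p : Subset N} {x} → x ∈ p → suc ∣ p - x ∣ ≡ ∣ p ∣
x∈p⇒suc∣p-x∣≡∣p∣ {p = inside ∷ p} here = cong (suc ∘ ∣_∣) (p─⊥≡p p)
x∈p⇒suc∣p-x∣≡∣p∣ {p = inside ∷ p} (there x∈p) = cong suc (x∈p⇒suc∣p-x∣≡∣p∣ x∈p)
x∈p⇒suc∣p-x∣≡∣p∣ {p = outside ∷ p} (there x∈p) = x∈p⇒suc∣p-x∣≡∣p∣ x∈p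

x∉p⇒p-x≡p : ∀ {N} {p : Subset N} {x} → x ∉ p → p - x ≡ p
x∉p⇒p-x≡p {p = inside ∷ p} {zero} x∉p = contradiction here x∉p
x∉p⇒p-x≡p {p = outside ∷ p} {zero} x∉p = cong (outside ∷_) (p─⊥≡p p)
x∉p⇒p-x≡p {p = b ∷ p} {suc x} x∉p = cong (b ∷_) (x∉p⇒p-x≡p (x∉p ∘ there))

∣p++q∣≡∣p∣+∣q∣ : ∀ {k l} (p : Subset k) (q : Subset l) → ∣ p ++ q ∣ ≡ ∣ p ∣ + ∣ q ∣
∣p++q∣≡∣p∣+∣q∣ [] q = refl
∣p++q∣≡∣p∣+∣q∣ (inside ∷ p) q = cong suc (∣p++q∣≡∣p∣+∣q∣ p q)
∣p++q∣≡∣p∣+∣q∣ (outside ∷ p) q = ∣p++q∣≡∣p∣+∣q∣ p q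

∣concat-replicate∣ : ∀ n {m} (p : Subset m) → ∣ concat (replicate n p) ∣ ≡ n * ∣ p ∣
∣concat-replicate∣ zero p = refl
∣concat-replicate∣ (suc n) p = trans (∣p++q∣≡∣p∣+∣q∣ p _) (cong (∣ p ∣ +_) (∣concat-replicate∣ n p))

CoversPairs : ∀ {N} → Subset N → Subset N → Set
CoversPairs p q = ∀ {x y} → x ∈ p → y ∈ p → x ≢ y → x ∈ q ⊎ y ∈ q

coversPairs-p-x : ∀ {N} (p : Subset N) x → CoversPairs p (p - x)
coversPairs-p-x p x {y} {z} y∈p z∈p y≢z with y ≟ x
... | yes refl = inj₂ (x∈p∧x≢y⇒x∈p-y z∈p (y≢z ∘ sym))
... | no y≢x = inj₁ (x∈p∧x≢y⇒x∈p-y y∈p y≢x)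

coversPairs⇒∣p∣≤1+∣q∣ : ∀ {N} {p q : Subset N} → CoversPairs p q → ∣ p ∣ ≤ suc ∣ q ∣
coversPairs⇒∣p∣≤1+∣q∣ {p = p} {q} covers with any? (λ x → x ∈? p ×-dec ¬? (x ∈? q))
... | yes (x , x∈p , x∉q) = begin
  ∣ p ∣           ≡⟨ sym (x∈p⇒suc∣p-x∣≡∣p∣ x∈p) ⟩
  suc ∣ p - x ∣   ≤⟨ s≤s (p⊆q⇒∣p∣≤∣q∣ p-x⊆q) ⟩
  suc ∣ q ∣       ∎
  where
  open ≤-Reasoning
  p-x⊆q : p - x ⊆ q
  p-x⊆q {y} y∈p-x with covers (p─q⊆p p _ y∈p-x) x∈p (x∈p-y⇒x≢y y∈p-x)
  ... | inj₁ y∈q = y∈q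
  ... | inj₂ x∈q = contradiction x∈q x∉q
... | no ∄ = ≤-trans (p⊆q⇒∣p∣≤∣q∣ p⊆q) (n≤1+n ∣ q ∣)
  where
  p⊆q : p ⊆ q
  p⊆q {y} y∈p with y ∈? q
  ... | yes y∈q = y∈q
  ... | no y∉q = contradiction (y , y∈p , y∉q) ∄

pairCover-∣p∣∸1 : ∀ {N} (p : Subset N) → ∃[ q ] (CoversPairs p q × ∣ q ∣ ≡ ∣ p ∣ ∸ 1)
pairCover-∣p∣∸1 {N} p with nonempty? p
... | yes (x , x∈p) = p - x , coversPairs-p-x p x , cong (_∸ 1) (x∈p⇒suc∣p-x∣≡∣p∣ x∈p)
... | no empty = p , (λ x∈p _ _ → inj₁ x∈p) , trans ∣p∣≡0 (sym (cong (_∸ 1) ∣p∣≡0))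
  where
  ∣p∣≡0 : ∣ p ∣ ≡ 0
  ∣p∣≡0 = trans (cong ∣_∣ (Empty-unique empty)) (∣⊥∣≡0 N)

∈-concat-replicate : ∀ {n m} {p : Subset m} i j → (combine {n} i j ∈ concat (replicate n p)) ⇔ (j ∈ p)
∈-concat-replicate {n} {m} {p} i j = mk⇔
  (λ ij∈ → lookup⇒[]= j p (trans (sym lookup-ij) ([]=⇒lookup ij∈)))
  (λ j∈p → lookup⇒[]= (combine i j) _ (trans lookup-ij ([]=⇒lookup j∈p)))
  where
  lookup-ij : lookup (concat (replicate n p)) (combine i j) ≡ lookup p j
  lookup-ij = trans (lookup-concat (replicate n p) i j) (cong (λ r → lookup r j) (lookup-replicate i p))

-- Shortest-path distance

infixr 5 _++ʷ_

_++ʷ_ : ∀ {N} {G : Graph N} {u z w a b} → Walk G u z a → Walk G z w b → Walk G u w (a + b)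
here ++ʷ q = q
step e p ++ʷ q = step e (p ++ʷ q)

module Metric {N} (G : Graph N) (simple : IsSimple G) (connected : Connected G) where

  edge-sym : ∀ {u w} → Edge G u w → Edge G w u
  edge-sym {u} {w} e rewrite proj₁ simple w u = e

  edge-irrefl : ∀ {u} → ¬ Edge G u u
  edge-irrefl {u} e = subst T (proj₂ simple u) e

  edge⇒≢ : ∀ {u w} → Edge G u w → u ≢ w
  edge⇒≢ e refl = edge-irrefl e

  reverse : ∀ {u w k} → Walk G u w k → Walk G w u k
  reverse here = here
  reverse {k = suc k} (step e p) = subst (Walk G _ _) (+-comm k 1) (reverse p ++ʷ step (edge-sym e) here)

  walk? : ∀ k u w → Dec (Walk G u w k)
  walk? zero u w with u ≟ w
  ... | yes refl = yes here
  ... | no u≢w = no λ { here → u≢w refl }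
  walk? (suc k) u w with any? (λ z → T? (adj G u z) ×-dec walk? k z w)
  ... | yes (z , e , p) = yes (step e p)
  ... | no ∄ = no λ { (step e p) → ∄ (_ , e , p) }

  private
    shortest : ∀ u w → ∃[ k ] (Walk G u w k × ∀ {j} → Walk G u w j → k ≤ j)
    shortest u w = least-witness (λ k → walk? k u w) (proj₂ (connected u w))

  d : Fin N → Fin N → ℕ
  d u w = proj₁ (shortest u w)

  d-walk : ∀ u w → Walk G u w (d u w)
  d-walk u w = proj₁ (proj₂ (shortest u w))

  d-minimal : ∀ {u w k} → Walk G u w k → d u w ≤ k
  d-minimal {u} {w} = proj₂ (proj₂ (shortest u w))

  d-Dist : ∀ u w → Dist G u w (d u w)
  d-Dist u w = d-walk u w , λ _ → d-minimal

  Dist⇒≡d : ∀ {u w a} → Dist G u w a → a ≡ d u w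
  Dist⇒≡d {u} {w} (p , minimal) = ≤-antisym (minimal _ (d-walk u w)) (d-minimal p)

  d-sym : ∀ u w → d u w ≡ d w u
  d-sym u w = ≤-antisym (d-minimal (reverse (d-walk w u))) (d-minimal (reverse (d-walk u w)))

  d-triangle : ∀ u z w → d u w ≤ d u z + d z w
  d-triangle u z w = d-minimal (d-walk u z ++ʷ d-walk z w)

  d-refl : ∀ u → d u u ≡ 0
  d-refl u = n≤0⇒n≡0 (d-minimal {u} here)

  d≡0⇒≡ : ∀ {u w} → d u w ≡ 0 → u ≡ w
  d≡0⇒≡ {u} {w} eq with subst (Walk G u w) eq (d-walk u w)
  ... | here = refl

  ≢⇒d≡suc : ∀ {u w} → u ≢ w → ∃[ k ] d u w ≡ suc k
  ≢⇒d≡suc {u} {w} u≢w with d u w in eq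
  ... | zero = contradiction (d≡0⇒≡ eq) u≢w
  ... | suc k = k , refl

  edge⇒d≡1 : ∀ {u w} → Edge G u w → d u w ≡ 1
  edge⇒d≡1 e with ≢⇒d≡suc (edge⇒≢ e)
  ... | k , eq = ≤-antisym (d-minimal (step e here)) (subst (1 ≤_) (sym eq) (s≤s z≤n))

  d≤1 : ∀ {u w} → u ≡ w ⊎ Edge G u w → d u w ≤ 1
  d≤1 (inj₁ refl) = ≤-trans (≤-reflexive (d-refl _)) z≤n
  d≤1 (inj₂ e) = ≤-reflexive (edge⇒d≡1 e)

  d-≤-edge : ∀ w {u z} → Edge G u z → d w z ≤ suc (d w u)
  d-≤-edge w {u} {z} e = begin
    d w z         ≤⟨ d-triangle w u z ⟩
    d w u + d u z ≡⟨ cong (d w u +_) (edge⇒d≡1 e) ⟩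
    d w u + 1     ≡⟨ +-comm (d w u) 1 ⟩
    suc (d w u)   ∎
    where open ≤-Reasoning

  geodesic-first-step : ∀ u w {k} → d u w ≡ suc k → ∃[ z ] (Edge G u z × d z w ≡ k)
  geodesic-first-step u w {k} eq with subst (Walk G u w) eq (d-walk u w)
  ... | step {z = z} e p = z , e , ≤-antisym (d-minimal p) (≤-pred (begin
    suc k         ≡⟨ eq ⟨
    d u w         ≤⟨ d-triangle u z w ⟩
    d u z + d z w ≡⟨ cong (_+ d z w) (edge⇒d≡1 e) ⟩
    suc (d z w)   ∎))
    where open ≤-Reasoning

  geodesic-last-step : ∀ u w {k} → d u w ≡ suc k → ∃[ z ] (Edge G z w × d u z ≡ k)
  geodesic-last-step u w eq with geodesic-first-step w u (trans (d-sym w u) eq)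
  ... | z , e , dzu = z , edge-sym e , trans (d-sym u z) dzu

  neighbour : 2 ≤ N → ∀ u → ∃[ z ] Edge G u z
  neighbour N≥2 u with another N≥2 u
  ... | w , u≢w with ≢⇒d≡suc u≢w
  ... | _ , eq with geodesic-first-step u w eq
  ... | z , e , _ = z , e

  -- Geodesics and maximally distant vertices

  Between : Fin N → Fin N → Fin N → Set
  Between u x w = d u w ≡ d u x + d x w

  Between⇒DistSum : ∀ {w x u} → Between w x u → DistSum G w u x
  Between⇒DistSum {w} {x} {u} b = _ , _ , _ , d-Dist w u , d-Dist w x , d-Dist x u , b

  DistSum⇒Between : ∀ {w x u} → DistSum G w u x → Between w x u
  DistSum⇒Between (_ , _ , _ , wu , wx , xu , eq)
    rewrite Dist⇒≡d wu | Dist⇒≡d wx | Dist⇒≡d xu = eq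

  between-refl : ∀ u x → Between u x x
  between-refl u x = sym (trans (cong (d u x +_) (d-refl x)) (+-identityʳ (d u x)))

  between-sym : ∀ {u x w} → Between u x w → Between w x u
  between-sym {u} {x} {w} b = begin
    d w u         ≡⟨ d-sym w u ⟩
    d u w         ≡⟨ b ⟩
    d u x + d x w ≡⟨ +-comm (d u x) (d x w) ⟩
    d x w + d u x ≡⟨ cong₂ _+_ (d-sym x w) (d-sym u x) ⟩
    d w x + d x u ∎
    where open ≡-Reasoning

  between-self : ∀ {u x} → Between u x u → x ≡ u
  between-self {u} {x} b = sym (d≡0⇒≡ (m+n≡0⇒m≡0 (d u x) (trans (sym b) (d-refl u))))

  between-trans : ∀ {t u x s} → Between t u x → Between t x s → Between u x s
  between-trans {t} {u} {x} {s} tux txs = ≤-antisym (d-triangle u x s) (+-cancelˡ-≤ (d t u) _ _ (begin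
    d t u + (d u x + d x s) ≡⟨ +-assoc (d t u) (d u x) (d x s) ⟨
    d t u + d u x + d x s   ≡⟨ cong (_+ d x s) tux ⟨
    d t x + d x s           ≡⟨ txs ⟨
    d t s                   ≤⟨ d-triangle t u s ⟩
    d t u + d u s           ∎))
    where open ≤-Reasoning

  MaxDist : Fin N → Fin N → Set
  MaxDist t x = ∀ z → Edge G t z → d x z ≤ d t x

  MaxDist⇒MaximallyDistant : ∀ {t x} → MaxDist t x → MaximallyDistant G t x
  MaxDist⇒MaximallyDistant md z e a b xz tx rewrite Dist⇒≡d xz | Dist⇒≡d tx = md z e

  MaximallyDistant⇒MaxDist : ∀ {t x} → MaximallyDistant G t x → MaxDist t x
  MaximallyDistant⇒MaxDist {t} {x} md z e = md z e _ _ (d-Dist x z) (d-Dist t x)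

  maxDist-irrefl : 2 ≤ N → ∀ u → ¬ MaxDist u u
  maxDist-irrefl N≥2 u md with neighbour N≥2 u
  ... | z , e = 1+n≰n (begin
    1     ≡⟨ edge⇒d≡1 e ⟨
    d u z ≤⟨ md z e ⟩
    d u u ≡⟨ d-refl u ⟩
    0     ∎)
    where open ≤-Reasoning

  maxDist-beyond : ∀ {t x s} → MaxDist t x → Between t x s → MaxDist t s
  maxDist-beyond {t} {x} {s} md txs z e = begin
    d s z         ≤⟨ d-triangle s x z ⟩
    d s x + d x z ≤⟨ +-monoʳ-≤ (d s x) (md z e) ⟩
    d s x + d t x ≡⟨ cong (d s x +_) (d-sym t x) ⟩
    d s x + d x t ≡⟨ between-sym txs ⟨
    d s t         ≡⟨ d-sym s t ⟩
    d t s         ∎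
    where open ≤-Reasoning

  -- Among the s with x on a u–s geodesic take one farthest from u; a neighbour farther still
  -- would again have x on its geodesic.
  furthest-beyond : ∀ u x → ∃[ s ] (Between u x s × MaxDist s u)
  furthest-beyond u x with maximise (λ s → d u s ≟ℕ d u x + d x s) (d u) (between-refl u x)
  ... | s , uxs , furthest = s , uxs , maximal
    where
    maximal : MaxDist s u
    maximal z e with d u z ≤? d u s
    ... | yes uz≤us = subst (d u z ≤_) (d-sym u s) uz≤us
    ... | no uz≰us = contradiction (furthest uxz) uz≰us
      where
      uz≡1+us : d u z ≡ suc (d u s)
      uz≡1+us = ≤-antisym (d-≤-edge u e) (≰⇒> uz≰us)
      uxz : Between u x z
      uxz = ≤-antisym (d-triangle u x z) (begin
        d u x + d x z       ≤⟨ +-monoʳ-≤ (d u x) (d-≤-edge x e) ⟩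
        d u x + suc (d x s) ≡⟨ +-suc (d u x) (d x s) ⟩
        suc (d u x + d x s) ≡⟨ cong suc uxs ⟨
        suc (d u s)         ≡⟨ uz≡1+us ⟨
        d u z               ∎)
        where open ≤-Reasoning

  mutual-partner : ∀ {t x} → MaxDist t x → ∃[ s ] (MaxDist t s × MaxDist s t)
  mutual-partner {t} {x} md with furthest-beyond t x
  ... | s , txs , mds = s , maxDist-beyond md txs , mds

  -- Strong metric generators

  -- The neighbours of q before and after it on a geodesic are adjacent, giving a shortcut.
  simplicial-geodesic-end : ∀ {q w p} → Simplicial G q → Between w q p → p ≢ q → w ≡ q
  simplicial-geodesic-end {q} {w} {p} simplicial wqp p≢q with w ≟ q
  ... | yes w≡q = w≡q
  ... | no w≢q with ≢⇒d≡suc w≢q | ≢⇒d≡suc (p≢q ∘ sym)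
  ... | k , wq≡1+k | l , qp≡1+l with geodesic-last-step w q wq≡1+k | geodesic-first-step q p qp≡1+l
  ... | y , yq , wy≡k | z , qz , zp≡l = contradiction shortcut 1+n≰n
    where
    yz≤1 : d y z ≤ 1
    yz≤1 with y ≟ z
    ... | yes y≡z = d≤1 (inj₁ y≡z)
    ... | no y≢z = d≤1 (inj₂ (simplicial y z (edge-sym yq) qz y≢z))
    shortcut : suc (k + suc l) ≤ k + suc l
    shortcut = begin
      suc k + suc l           ≡⟨ cong₂ _+_ wq≡1+k qp≡1+l ⟨
      d w q + d q p           ≡⟨ wqp ⟨
      d w p                   ≤⟨ d-triangle w y p ⟩
      d w y + d y p           ≤⟨ +-monoʳ-≤ (d w y) (d-triangle y z p) ⟩
      d w y + (d y z + d z p) ≤⟨ +-mono-≤ (≤-reflexive wy≡k) (+-mono-≤ yz≤1 (≤-reflexive zp≡l)) ⟩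
      k + suc l               ∎
      where open ≤-Reasoning

  -- Extend u, x to a geodesic t … u … x … s with t and s mutually maximally distant.
  strongMetricGenerator-of-cover : (S : Subset N) →
    (∀ {t s} → MaxDist t s → MaxDist s t → t ≢ s → t ∈ S ⊎ s ∈ S) → IsStrongMetricGenerator G S
  strongMetricGenerator-of-cover S covers u x u≢x with furthest-beyond x u
  ... | t , xut , mdt with furthest-beyond t x
  ... | s , txs , mds with covers (maxDist-beyond mdt txs) mds t≢s
    where
    t≢s : t ≢ s
    t≢s refl with between-self txs
    ... | refl = u≢x (between-self xut)
  ... | inj₁ t∈S = t , t∈S , inj₂ (Between⇒DistSum (between-sym xut))
  ... | inj₂ s∈S = s , s∈S , inj₁ (Between⇒DistSum (between-sym (between-trans (between-sym xut) txs)))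

  generator-meets-simplicial-pair : ∀ {S p q} → IsStrongMetricGenerator G S →
    Simplicial G p → Simplicial G q → p ≢ q → p ∈ S ⊎ q ∈ S
  generator-meets-simplicial-pair {S} generator sp sq p≢q with generator _ _ p≢q
  ... | w , w∈S , inj₁ wqp = inj₂ (subst (_∈ S) (simplicial-geodesic-end sq (DistSum⇒Between wqp) p≢q) w∈S)
  ... | w , w∈S , inj₂ wpq = inj₁ (subst (_∈ S) (simplicial-geodesic-end sp (DistSum⇒Between wpq) (p≢q ∘ sym)) w∈S)

  strongMetricDimension-of-simplicial-cover : (B : Subset N) →
    (∀ {p} → p ∈ B → Simplicial G p) → (∀ {p q} → MaximallyDistant G p q → p ∈ B) →
    StrongMetricDimension G (∣ B ∣ ∸ 1)
  strongMetricDimension-of-simplicial-cover B simplicial maxDist∈B with pairCover-∣p∣∸1 B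
  ... | S , covers , ∣S∣≡∣B∣∸1 = (S , generator , ∣S∣≡∣B∣∸1) , minimal
    where
    ∈B : ∀ {t s} → MaxDist t s → t ∈ B
    ∈B = maxDist∈B ∘ MaxDist⇒MaximallyDistant
    generator : IsStrongMetricGenerator G S
    generator = strongMetricGenerator-of-cover S (λ mts mst → covers (∈B mts) (∈B mst))
    minimal : ∀ S′ → IsStrongMetricGenerator G S′ → ∣ B ∣ ∸ 1 ≤ ∣ S′ ∣
    minimal S′ generator′ = ∸-monoˡ-≤ 1 (coversPairs⇒∣p∣≤1+∣q∣ λ p∈B q∈B →
      generator-meets-simplicial-pair generator′ (simplicial p∈B) (simplicial q∈B))

-- The rooted product

T⇔T⇒≡ : ∀ {x y} → (T x → T y) → (T y → T x) → x ≡ y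
T⇔T⇒≡ {true} {true} _ _ = refl
T⇔T⇒≡ {true} {false} x⇒y _ = contradiction _ x⇒y
T⇔T⇒≡ {false} {true} _ y⇒x = contradiction _ y⇒x
T⇔T⇒≡ {false} {false} _ _ = refl

T-∧∨∧∧ : ∀ {a b c d e} → T ((a ∧ b) ∨ (c ∧ (d ∧ e))) ⇔ ((T a × T b) ⊎ (T c × T d × T e))
T-∧∨∧∧ {a} {b} {c} {d} {e} = mk⇔
  (Sum.map (Equivalence.to (T-∧ {a})) (Prod.map₂ (Equivalence.to (T-∧ {d})) ∘ Equivalence.to (T-∧ {c}))
    ∘ Equivalence.to (T-∨ {a ∧ b}))
  (Equivalence.from (T-∨ {a ∧ b})
    ∘ Sum.map (Equivalence.from (T-∧ {a})) (Equivalence.from (T-∧ {c}) ∘ Prod.map₂ (Equivalence.from (T-∧ {d}))))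

module Rooted {n m} (G : Graph n) (H : Graph m) (v : Fin m)
  (simpleG : IsSimple G) (simpleH : IsSimple H) (connectedG : Connected G) (connectedH : Connected H) where

  X : Graph (n * m)
  X = RootedProduct G H v

  module MG = Metric G simpleG connectedG
  module MH = Metric H simpleH connectedH

  ⟪_,_⟫ : Fin n → Fin m → Fin (n * m)
  ⟪_,_⟫ = combine

  πᴳ : Fin (n * m) → Fin n
  πᴳ p = proj₁ (remQuot {n} m p)

  πᴴ : Fin (n * m) → Fin m
  πᴴ p = proj₂ (remQuot {n} m p)

  πᴳ-⟪⟫ : ∀ i b → πᴳ ⟪ i , b ⟫ ≡ i
  πᴳ-⟪⟫ i b = cong proj₁ (remQuot-combine i b)

  πᴴ-⟪⟫ : ∀ i b → πᴴ ⟪ i , b ⟫ ≡ b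
  πᴴ-⟪⟫ i b = cong proj₂ (remQuot-combine i b)

  ⟪πᴳ,πᴴ⟫ : ∀ p → ⟪ πᴳ p , πᴴ p ⟫ ≡ p
  ⟪πᴳ,πᴴ⟫ = combine-remQuot {n} m

  ProductEdge : Fin (n * m) → Fin (n * m) → Set
  ProductEdge p q = (πᴳ p ≡ πᴳ q × Edge H (πᴴ p) (πᴴ q))
                  ⊎ (πᴴ p ≡ v × πᴴ q ≡ v × Edge G (πᴳ p) (πᴳ q))

  edge-unfold : ∀ p q → Edge X p q ⇔
    ((T ⌊ πᴳ p ≟ πᴳ q ⌋ × Edge H (πᴴ p) (πᴴ q))
     ⊎ (T ⌊ πᴴ p ≟ v ⌋ × T ⌊ πᴴ q ≟ v ⌋ × Edge G (πᴳ p) (πᴳ q)))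
  edge-unfold p q = T-∧∨∧∧

  edge⇒productEdge : ∀ {p q} → Edge X p q → ProductEdge p q
  edge⇒productEdge {p} {q} = Sum.map (Prod.map₁ toWitness) (Prod.map toWitness (Prod.map₁ toWitness))
                           ∘ Equivalence.to (edge-unfold p q)

  productEdge⇒edge : ∀ {p q} → ProductEdge p q → Edge X p q
  productEdge⇒edge {p} {q} = Equivalence.from (edge-unfold p q)
                           ∘ Sum.map (Prod.map₁ fromWitness) (Prod.map fromWitness (Prod.map₁ fromWitness))

  copy-edge : ∀ i {b c} → Edge H b c → Edge X ⟪ i , b ⟫ ⟪ i , c ⟫
  copy-edge i {b} {c} e = productEdge⇒edge (inj₁
    (trans (πᴳ-⟪⟫ i b) (sym (πᴳ-⟪⟫ i c)) , subst₂ (Edge H) (sym (πᴴ-⟪⟫ i b)) (sym (πᴴ-⟪⟫ i c)) e))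

  root-edge : ∀ {i j} → Edge G i j → Edge X ⟪ i , v ⟫ ⟪ j , v ⟫
  root-edge {i} {j} e = productEdge⇒edge (inj₂
    (πᴴ-⟪⟫ i v , πᴴ-⟪⟫ j v , subst₂ (Edge G) (sym (πᴳ-⟪⟫ i v)) (sym (πᴳ-⟪⟫ j v)) e))

  copy-walk : ∀ i {b c k} → Walk H b c k → Walk X ⟪ i , b ⟫ ⟪ i , c ⟫ k
  copy-walk i here = here
  copy-walk i (step e w) = step (copy-edge i e) (copy-walk i w)

  root-walk : ∀ {i j k} → Walk G i j k → Walk X ⟪ i , v ⟫ ⟪ j , v ⟫ k
  root-walk here = here
  root-walk (step e w) = step (root-edge e) (root-walk w)

  productEdge-sym : ∀ {p q} → ProductEdge p q → ProductEdge q p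
  productEdge-sym (inj₁ (gp≡gq , e)) = inj₁ (sym gp≡gq , MH.edge-sym e)
  productEdge-sym (inj₂ (hp≡v , hq≡v , e)) = inj₂ (hq≡v , hp≡v , MG.edge-sym e)

  productEdge-irrefl : ∀ {p} → ¬ ProductEdge p p
  productEdge-irrefl (inj₁ (_ , e)) = MH.edge-irrefl e
  productEdge-irrefl (inj₂ (_ , _ , e)) = MG.edge-irrefl e

  simpleX : IsSimple X
  simpleX = (λ p q → T⇔T⇒≡ (productEdge⇒edge ∘ productEdge-sym ∘ edge⇒productEdge {p} {q})
                           (productEdge⇒edge ∘ productEdge-sym ∘ edge⇒productEdge {q} {p}))
          , (λ p → T⇔T⇒≡ (productEdge-irrefl ∘ edge⇒productEdge {p}) λ ())

  connectedX : Connected X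
  connectedX p q = subst₂ (λ a c → ∃ (Walk X a c)) (⟪πᴳ,πᴴ⟫ p) (⟪πᴳ,πᴴ⟫ q) (_ ,
    copy-walk (πᴳ p) (MH.d-walk (πᴴ p) v)
      ++ʷ root-walk (MG.d-walk (πᴳ p) (πᴳ q))
      ++ʷ copy-walk (πᴳ q) (MH.d-walk v (πᴴ q)))

  module MX = Metric X simpleX connectedX

  π-injective : ∀ {p q} → πᴳ p ≡ πᴳ q → πᴴ p ≡ πᴴ q → p ≡ q
  π-injective {p} {q} gp≡gq hp≡hq = trans (sym (⟪πᴳ,πᴴ⟫ p)) (trans (cong₂ ⟪_,_⟫ gp≡gq hp≡hq) (⟪πᴳ,πᴴ⟫ q))

  retract : Fin n → Fin (n * m) → Fin m
  retract i p with πᴳ p ≟ i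
  ... | yes _ = πᴴ p
  ... | no _ = v

  retract-⟪⟫ : ∀ i b → retract i ⟪ i , b ⟫ ≡ b
  retract-⟪⟫ i b with πᴳ ⟪ i , b ⟫ ≟ i
  ... | yes _ = πᴴ-⟪⟫ i b
  ... | no ≢i = contradiction (πᴳ-⟪⟫ i b) ≢i

  retract-edge : ∀ i {p q} → Edge X p q → retract i p ≡ retract i q ⊎ Edge H (retract i p) (retract i q)
  retract-edge i {p} {q} e with edge⇒productEdge e | πᴳ p ≟ i | πᴳ q ≟ i
  ... | inj₁ (_ , eH)            | yes _     | yes _     = inj₂ eH
  ... | inj₁ (gp≡gq , _)         | yes gp≡i  | no gq≢i   = contradiction (trans (sym gp≡gq) gp≡i) gq≢i
  ... | inj₁ (gp≡gq , _)         | no gp≢i   | yes gq≡i  = contradiction (trans gp≡gq gq≡i) gp≢i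
  ... | inj₁ _                   | no _      | no _      = inj₁ refl
  ... | inj₂ (hp≡v , hq≡v , _)   | yes _     | yes _     = inj₁ (trans hp≡v (sym hq≡v))
  ... | inj₂ (hp≡v , _ , _)      | yes _     | no _      = inj₁ hp≡v
  ... | inj₂ (_ , hq≡v , _)      | no _      | yes _     = inj₁ (sym hq≡v)
  ... | inj₂ _                   | no _      | no _      = inj₁ refl

  d-retract : ∀ i {p q k} → Walk X p q k → MH.d (retract i p) (retract i q) ≤ k
  d-retract i {p} here = ≤-reflexive (MH.d-refl (retract i p))
  d-retract i {p} {q} (step {z = z} e w) = begin
    MH.d (ρ p) (ρ q)                    ≤⟨ MH.d-triangle (ρ p) (ρ z) (ρ q) ⟩
    MH.d (ρ p) (ρ z) + MH.d (ρ z) (ρ q) ≤⟨ +-mono-≤ (MH.d≤1 (retract-edge i e)) (d-retract i w) ⟩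
    suc _                               ∎
    where
    open ≤-Reasoning
    ρ : Fin (n * m) → Fin m
    ρ = retract i

  d-copy : ∀ i b c → MX.d ⟪ i , b ⟫ ⟪ i , c ⟫ ≡ MH.d b c
  d-copy i b c = ≤-antisym (MX.d-minimal (copy-walk i (MH.d-walk b c)))
    (subst₂ (λ x y → MH.d x y ≤ MX.d ⟪ i , b ⟫ ⟪ i , c ⟫) (retract-⟪⟫ i b) (retract-⟪⟫ i c)
      (d-retract i (MX.d-walk ⟪ i , b ⟫ ⟪ i , c ⟫)))

  -- A walk into copy i from outside passes through its root ⟪ i , v ⟫.
  entering-copy : ∀ i {p q k} → Walk X p q k → πᴳ p ≢ i → πᴳ q ≡ i →
    MX.d p ⟪ i , v ⟫ + MX.d ⟪ i , v ⟫ q ≤ k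
  entering-copy i here gp≢i gq≡i = contradiction gq≡i gp≢i
  entering-copy i {p} {q} (step {z = z} e w) gp≢i gq≡i with πᴳ z ≟ i
  ... | no gz≢i = begin
    MX.d p r + MX.d r q            ≤⟨ +-monoˡ-≤ (MX.d r q) (MX.d-triangle p z r) ⟩
    MX.d p z + MX.d z r + MX.d r q ≡⟨ cong (λ x → x + MX.d z r + MX.d r q) (MX.edge⇒d≡1 e) ⟩
    suc (MX.d z r + MX.d r q)      ≤⟨ s≤s (entering-copy i w gz≢i gq≡i) ⟩
    suc _                          ∎
    where
    open ≤-Reasoning
    r : Fin (n * m)
    r = ⟪ i , v ⟫
  ... | yes gz≡i with edge⇒productEdge e
  ...   | inj₁ (gp≡gz , _) = contradiction (trans gp≡gz gz≡i) gp≢i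
  ...   | inj₂ (_ , hz≡v , _) =
    +-mono-≤ (MX.d≤1 (inj₂ (subst (Edge X p) z≡r e))) (MX.d-minimal (subst (λ a → Walk X a q _) z≡r w))
    where
    z≡r : z ≡ ⟪ i , v ⟫
    z≡r = trans (sym (⟪πᴳ,πᴴ⟫ z)) (cong₂ ⟪_,_⟫ gz≡i hz≡v)

  d-via-root : ∀ i {p} y → πᴳ p ≢ i → MX.d p ⟪ i , y ⟫ ≡ MX.d p ⟪ i , v ⟫ + MH.d v y
  d-via-root i {p} y gp≢i = ≤-antisym
    (≤-trans (MX.d-triangle p ⟪ i , v ⟫ ⟪ i , y ⟫) (≤-reflexive via-copy))
    (≤-trans (≤-reflexive (sym via-copy)) (entering-copy i (MX.d-walk p ⟪ i , y ⟫) gp≢i (πᴳ-⟪⟫ i y)))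
    where
    via-copy : MX.d p ⟪ i , v ⟫ + MX.d ⟪ i , v ⟫ ⟪ i , y ⟫ ≡ MX.d p ⟪ i , v ⟫ + MH.d v y
    via-copy = cong (MX.d p ⟪ i , v ⟫ +_) (d-copy i v y)

  maxDist-same-copy : ∀ {i b c} → MX.MaxDist ⟪ i , b ⟫ ⟪ i , c ⟫ → MH.MaxDist b c
  maxDist-same-copy {i} {b} {c} md z e = subst₂ _≤_ (d-copy i c z) (d-copy i b c) (md _ (copy-edge i e))

  maxDist-other-copy : ∀ {i b q} → πᴳ q ≢ i → MX.MaxDist ⟪ i , b ⟫ q → MH.MaxDist b v
  maxDist-other-copy {i} {b} {q} gq≢i md z e = +-cancelˡ-≤ (MX.d q ⟪ i , v ⟫) _ _ (begin
    MX.d q ⟪ i , v ⟫ + MH.d v z ≡⟨ d-via-root i z gq≢i ⟨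
    MX.d q ⟪ i , z ⟫            ≤⟨ md _ (copy-edge i e) ⟩
    MX.d ⟪ i , b ⟫ q            ≡⟨ MX.d-sym ⟪ i , b ⟫ q ⟩
    MX.d q ⟪ i , b ⟫            ≡⟨ d-via-root i b gq≢i ⟩
    MX.d q ⟪ i , v ⟫ + MH.d v b ≡⟨ cong (MX.d q ⟪ i , v ⟫ +_) (MH.d-sym v b) ⟩
    MX.d q ⟪ i , v ⟫ + MH.d b v ∎)
    where open ≤-Reasoning

  root-not-maxDist-in-copy : 2 ≤ n → ∀ {i c} → ¬ MX.MaxDist ⟪ i , v ⟫ ⟪ i , c ⟫
  root-not-maxDist-in-copy n≥2 {i} {c} md with MG.neighbour n≥2 i
  ... | j , e = 1+n≰n (begin
    suc (MH.d v c)                      ≡⟨ cong (_+ MH.d v c) (MX.edge⇒d≡1 (root-edge (MG.edge-sym e))) ⟨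
    MX.d ⟪ j , v ⟫ ⟪ i , v ⟫ + MH.d v c ≡⟨ d-via-root i c gj≢i ⟨
    MX.d ⟪ j , v ⟫ ⟪ i , c ⟫            ≡⟨ MX.d-sym ⟪ j , v ⟫ ⟪ i , c ⟫ ⟩
    MX.d ⟪ i , c ⟫ ⟪ j , v ⟫            ≤⟨ md _ (root-edge e) ⟩
    MX.d ⟪ i , v ⟫ ⟪ i , c ⟫            ≡⟨ d-copy i v c ⟩
    MH.d v c                            ∎)
    where
    open ≤-Reasoning
    gj≢i : πᴳ ⟪ j , v ⟫ ≢ i
    gj≢i gj≡i = MG.edge⇒≢ e (sym (trans (sym (πᴳ-⟪⟫ j v)) gj≡i))

  maxDist⇒maxDistᴴ : 2 ≤ n → 2 ≤ m → ∀ {i b q} → MX.MaxDist ⟪ i , b ⟫ q → b ≢ v × ∃[ c ] MH.MaxDist b c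
  maxDist⇒maxDistᴴ n≥2 m≥2 {i} {b} {q} md with πᴳ q ≟ i
  ... | yes gq≡i = (λ { refl → root-not-maxDist-in-copy n≥2 md′ }) , πᴴ q , maxDist-same-copy md′
    where
    md′ : MX.MaxDist ⟪ i , b ⟫ ⟪ i , πᴴ q ⟫
    md′ = subst (MX.MaxDist ⟪ i , b ⟫) (trans (sym (⟪πᴳ,πᴴ⟫ q)) (cong (⟪_, πᴴ q ⟫) gq≡i)) md
  ... | no gq≢i = (λ { refl → MH.maxDist-irrefl m≥2 v mdH }) , v , mdH
    where
    mdH : MH.MaxDist b v
    mdH = maxDist-other-copy gq≢i md

  maxDist⇒boundary : 2 ≤ n → 2 ≤ m → ∀ {p q} → MaximallyDistant X p q → πᴴ p ≢ v × InBoundary H (πᴴ p)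
  maxDist⇒boundary n≥2 m≥2 {p} md
    with maxDist⇒maxDistᴴ n≥2 m≥2
           (subst (λ a → MX.MaxDist a _) (sym (⟪πᴳ,πᴴ⟫ p)) (MX.MaximallyDistant⇒MaxDist md))
  ... | hp≢v , _ , mdH with MH.mutual-partner mdH
  ... | s , hp-s , s-hp = hp≢v , s , MH.MaxDist⇒MaximallyDistant hp-s , MH.MaxDist⇒MaximallyDistant s-hp

  simplicial-lift : ∀ {p} → Simplicial H (πᴴ p) → πᴴ p ≢ v → Simplicial X p
  simplicial-lift {p} simplicial hp≢v y z ey ez y≢z with edge⇒productEdge ey | edge⇒productEdge ez
  ... | inj₂ (hp≡v , _) | _ = contradiction hp≡v hp≢v
  ... | inj₁ _ | inj₂ (hp≡v , _) = contradiction hp≡v hp≢v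
  ... | inj₁ (gp≡gy , ey′) | inj₁ (gp≡gz , ez′) = productEdge⇒edge (inj₁ (gy≡gz ,
        simplicial (πᴴ y) (πᴴ z) ey′ ez′ (y≢z ∘ π-injective gy≡gz)))
    where
    gy≡gz : πᴳ y ≡ πᴳ z
    gy≡gz = trans (sym gp≡gy) gp≡gz

  rootedProduct-strongMetricDimension : 2 ≤ n → 2 ≤ m → (∀ u → InBoundary H u → Simplicial H u) →
    (∂H : Subset m) → (∀ u → (u ∈ ∂H) ⇔ InBoundary H u) → StrongMetricDimension X (n * ∣ ∂H - v ∣ ∸ 1)
  rootedProduct-strongMetricDimension n≥2 m≥2 boundary⇒simplicial ∂H ∂H⇔boundary =
    subst (λ k → StrongMetricDimension X (k ∸ 1)) (∣concat-replicate∣ n (∂H - v))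
      (MX.strongMetricDimension-of-simplicial-cover B simplicial maxDist∈B)
    where
    -- In the combine encoding of V(X), concat (replicate n S) is V(G) × S.
    B : Subset (n * m)
    B = concat (replicate n (∂H - v))
    ∈B⇔ : ∀ p → (p ∈ B) ⇔ (πᴴ p ∈ ∂H - v)
    ∈B⇔ p = subst (λ a → (a ∈ B) ⇔ (πᴴ p ∈ ∂H - v)) (⟪πᴳ,πᴴ⟫ p) (∈-concat-replicate (πᴳ p) (πᴴ p))
    simplicial : ∀ {p} → p ∈ B → Simplicial X p
    simplicial {p} p∈B = simplicial-lift
      (boundary⇒simplicial (πᴴ p) (Equivalence.to (∂H⇔boundary (πᴴ p)) (p─q⊆p ∂H ⁅ v ⁆ hp∈)))
      (x∈p-y⇒x≢y hp∈)
      where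
      hp∈ : πᴴ p ∈ ∂H - v
      hp∈ = Equivalence.to (∈B⇔ p) p∈B
    maxDist∈B : ∀ {p q} → MaximallyDistant X p q → p ∈ B
    maxDist∈B {p} md = Equivalence.from (∈B⇔ p)
      (x∈p∧x≢y⇒x∈p-y (Equivalence.from (∂H⇔boundary (πᴴ p)) (proj₂ hp)) (proj₁ hp))
      where
      hp : πᴴ p ≢ v × InBoundary H (πᴴ p)
      hp = maxDist⇒boundary n≥2 m≥2 md

theorem7 : ∀ {n m} (G : Graph n) (H : Graph m) (v : Fin m) (∂H : Subset m) →
    2 ≤ n → 2 ≤ m →
    IsSimple G → IsSimple H → Connected G → Connected H →
    (∀ u → InBoundary H u ⇔ Simplicial H u) →
    (∀ u → u ∈ ∂H ⇔ InBoundary H u) →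
    (v ∈ ∂H → StrongMetricDimension (RootedProduct G H v) (n * (∣ ∂H ∣ ∸ 1) ∸ 1)) ×
    (v ∉ ∂H → StrongMetricDimension (RootedProduct G H v) (n * ∣ ∂H ∣ ∸ 1))
theorem7 {n} G H v ∂H n≥2 m≥2 simpleG simpleH connectedG connectedH boundary⇔simplicial ∂H⇔boundary =
    (λ v∈∂H → subst (λ k → StrongMetricDimension X (n * k ∸ 1))
                    (cong (_∸ 1) (x∈p⇒suc∣p-x∣≡∣p∣ v∈∂H)) dim)
  , (λ v∉∂H → subst (λ S → StrongMetricDimension X (n * ∣ S ∣ ∸ 1)) (x∉p⇒p-x≡p v∉∂H) dim)
  where
  open Rooted G H v simpleG simpleH connectedG connectedH
  dim : StrongMetricDimension X (n * ∣ ∂H - v ∣ ∸ 1)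
  dim = rootedProduct-strongMetricDimension n≥2 m≥2 (Equivalence.to ∘ boundary⇔simplicial) ∂H ∂H⇔boundary
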